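{- Let $G$ be a connected graph admitting a local antimagic labeling, and let $f$ be a local antimagic labeling of $G$ inducing exactly $\chi_{la}(G)$ distinct vertex colors. Let $n\ge 3$. Suppose that for all $u,v\in V(G)$: (i) $f^+(u)=f^+(v)$ implies $\deg(u)=\deg(v)$; and (ii) $f^+(u)\ne f^+(v)$ implies $f^+(u)n^3-\frac{(n^3-n)\deg(u)}{2}\ne f^+(v)n^3-\frac{(n^3-n)\deg(v)}{2}$. Then $\chi(G[O_n])\le \chi_{la}(G[O_n])\le \chi_{la}(G)$. Moreover, $\chi_{la}(G[O_n])=\chi_{la}(G)$ holds if, in addition, (a) $\chi(G)=\chi_{la}(G)$, or (b) $G$ is bipartite with both partite sets of the same size and $\chi_{la}(G)=3$.
   Context: All graphs are finite and simple. For a graph $G=(V,E)$ with $q$ edges, a bijection $f:E\to\{1,\ldots,q\}$ is a local antimagic labeling if $f^+(u)\ne f^+(v)$ for all adjacent $u,v$, where $f^+(u)=\sum_{e\ni u} f(e)$ is the sum of labels of edges incident to $u$; it induces the proper vertex coloring $v\mapsto f^+(v)$. $\chi_{la}(G)$ is the minimum number of distinct values of $f^+$ over all local antimagic labelings of $G$. $\chi(G)$ is the chromatic number. $O_n$ denotes the null (edgeless) graph on $n$ vertices. For graphs $G,H$, the lexicographic product $G[H]$ has vertex set $V(G)\times V(H)$, with $(u,u')$ adjacent to $(v,v')$ iff $uv\in E(G)$, or $u=v$ and $u'v'\in E(H)$. Thus $G[O_n]$ replaces each vertex $u$ of $G$ by $n$ independent vertices and each edge $uv$ by a copy of $K_{n,n}$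 between the corresponding sets. -}

module Defs where

open import Data.Nat using (ℕ; zero; suc; _+_; _*_; _∸_; _^_; _≤_)
open import Data.Nat.Properties using () renaming (_≟_ to _≟ℕ_)
open import Data.Fin using (Fin; toℕ; combine; remQuot) renaming (_≟_ to _≟F_)
open import Data.Bool using (Bool; true; false; if_then_else_; _∨_)
open import Data.Product using (Σ; ∃; _×_; _,_; proj₁; proj₂)
open import Data.Sum using (_⊎_)
open import Data.List using (List; length; map; deduplicate; filter)
open import Data.List.Base using (allFin)
open import Relation.Nullary using (¬_; does)
open import Relation.Binary.PropositionalEquality using (_≡_; _≢_)
open import Function.Definitions using (Bijective)

∑ : (n : ℕ) → (Fin n → ℕ) → ℕ
∑ zero    f = 0
∑ (suc n) f = f Fin.zero + ∑ n (λ i → f (Fin.suc i))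

-- A (multi)graph on vertex set Fin V with edges Fin q, each edge given by its
-- two end vertices.  Simplicity is a separate predicate.
record Graph : Set where
  constructor mkGraph
  field
    V     : ℕ
    q     : ℕ
    ends  : Fin q → Fin V × Fin V
open Graph public

SameEnds : ∀ {V} → Fin V × Fin V → Fin V × Fin V → Set
SameEnds (a , b) (c , d) = (a ≡ c × b ≡ d) ⊎ (a ≡ d × b ≡ c)

Simple : Graph → Set
Simple G = (∀ e → proj₁ (ends G e) ≢ proj₂ (ends G e))
         × (∀ e e′ → SameEnds (ends G e) (ends G e′) → e ≡ e′)

Adj : (G : Graph) → Fin (V G) → Fin (V G) → Set
Adj G u v = ∃ λ e → SameEnds (ends G e) (u , v)

data Reach (G : Graph) (u : Fin (V G)) : Fin (V G) → Set where
  here : Reach G u u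
  step : ∀ {v w} → Reach G u v → Adj G v w → Reach G u w

Connected : Graph → Set
Connected G = ∀ u v → Reach G u v

incident : (G : Graph) → Fin (V G) → Fin (q G) → Bool
incident G u e = does (u ≟F proj₁ (ends G e)) ∨ does (u ≟F proj₂ (ends G e))

deg : (G : Graph) → Fin (V G) → ℕ
deg G u = ∑ (q G) (λ e → if incident G u e then 1 else 0)

-- An edge labeling: a bijection E → {1,…,q}, encoded as a bijection
-- Fin q → Fin q, edge e receiving label 1 + toℕ (lab e).
record Labeling (G : Graph) : Set where
  constructor mkLabeling
  field
    lab   : Fin (q G) → Fin (q G)
    bij   : Bijective _≡_ _≡_ lab
open Labeling public

label : {G : Graph} → Labeling G → Fin (q G) → ℕ
label f e = suc (toℕ (lab f e))

vsum : (G : Graph) → Labeling G → Fin (V G) → ℕ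
vsum G f u = ∑ (q G) (λ e → if incident G u e then label {G} f e else 0)

IsLocalAntimagic : (G : Graph) → Labeling G → Set
IsLocalAntimagic G f = ∀ u v → Adj G u v → vsum G f u ≢ vsum G f v

numValues : ∀ {V} → (Fin V → ℕ) → ℕ
numValues {V} c = length (deduplicate _≟ℕ_ (map c (allFin V)))

colorsOf : (G : Graph) → Labeling G → ℕ
colorsOf G f = numValues (vsum G f)

IsChiLa : Graph → ℕ → Set
IsChiLa G k =
  (Σ (Labeling G) λ f → IsLocalAntimagic G f × colorsOf G f ≡ k)
  × (∀ (f : Labeling G) → IsLocalAntimagic G f → k ≤ colorsOf G f)

ProperColoring : (G : Graph) → (k : ℕ) → (Fin (V G) → Fin k) → Set
ProperColoring G k c = ∀ u v → Adj G u v → c u ≢ c v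

IsChromatic : Graph → ℕ → Set
IsChromatic G k =
  (Σ (Fin (V G) → Fin k) λ c → ProperColoring G k c)
  × (∀ m (c : Fin (V G) → Fin m) → ProperColoring G m c → k ≤ m)

count : ∀ {V} → (Fin V → Bool) → Bool → ℕ
count {V} p b = ∑ V (λ u → if does (Data.Bool._≟_ (p u) b) then 1 else 0)
  where import Data.Bool

BalancedBipartite : Graph → Set
BalancedBipartite G = Σ (Fin (V G) → Bool) λ p →
  (∀ u v → Adj G u v → p u ≢ p v) × count p true ≡ count p false

-- Lexicographic product G[O_n]: vertex (u,i) ↦ combine u i;
-- edge (e,(i,j)) with ends e = (a,b) joins (a,i) and (b,j).
lexNull : Graph → ℕ → Graph
lexNull G n = mkGraph (V G * n) (q G * (n * n)) E
  where
  E : Fin (q G * (n * n)) → Fin (V G * n) × Fin (V G * n)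
  E x with remQuot {q G} (n * n) x
  ... | e , r with remQuot {n} n r
  ... | i , j = combine (proj₁ (ends G e)) i , combine (proj₂ (ends G e)) j

{-# OPTIONS --safe #-}
-- Let M be a semi-magic square of order n with entries 0, …, n² − 1; it exists for every
-- n ≥ 3 (odd orders from two orthogonal cyclic Latin squares, order 4 explicitly, order 2m
-- from order m by inflating each entry into a 2 × 2 block). Label the edge of G[O_n] joining
-- (u, i) and (v, j), for an edge e = uv of G, by n² (f(e) − 1) + M(i, j) + 1. Since the rows
-- and columns of M all sum to (n³ − n)/2, the vertex (u, i) receives the sum
-- f⁺(u) n³ − (n³ − n) deg(u)/2: by (ii) this labeling is local antimagic, and by (i) it has
-- at most as many sums as f, so χ_la(G[O_n]) ≤ χ_la(G); always χ ≤ χ_la. In case (a) a fibre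
-- of G[O_n] is a copy of G, so χ(G) ≤ χ_la(G[O_n]). In case (b) G[O_n] is connected and
-- balanced bipartite, which rules out local antimagic labelings with two sums.
module Submission where

open import Defs
open import Data.Nat
open import Data.Nat.Properties
open import Data.Nat.DivMod
open import Data.Nat.Induction using (<-rec)
open import Data.Nat.Tactic.RingSolver using (solve-∀)
import Data.Integer as ℤ
import Data.Integer.Properties as ℤₚ
open import Data.Fin as Fin using (Fin; zero; suc; toℕ; fromℕ<; combine; remQuot; punchIn; punchOut; _↑ˡ_; _↑ʳ_) renaming (_≟_ to _≟ᶠ_)
open import Data.Fin.Properties using (toℕ-fromℕ<; toℕ<n; toℕ-injective; toℕ-combine; remQuot-combine; combine-remQuot; combine-injectiveˡ; combine-injectiveʳ; any?; all?; ¬∀⟶∃¬; punchOut-injective; punchIn-punchOut; injective⇒≤) renaming (suc-injective to suc-injectiveᶠ)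
open import Data.Bool using (Bool; true; false; if_then_else_; _∨_; _∧_; _xor_; not) renaming (_≟_ to _≟ᵇ_)
open import Data.Bool.Properties using (∨-identityʳ; ∨-zeroʳ; ¬-not; not-injective; not-involutive; not-distribˡ-xor; not-distribʳ-xor)
open import Data.List using (List; []; _∷_; length; map; deduplicate; allFin; lookup)
open import Data.List.Properties using (length-map; map-cong)
open import Data.List.Membership.Propositional using (_∈_)
open import Data.List.Membership.Propositional.Properties using (∈-map⁺; ∈-map⁻; ∈-allFin; ∈-deduplicate⁺; ∈-deduplicate⁻)
open import Data.List.Relation.Unary.Any using (here; there; index)
open import Data.List.Relation.Unary.Any.Properties using (lookup-index)
open import Data.List.Relation.Unary.All as All using ([]; _∷_)
open import Data.List.Relation.Unary.Unique.Propositional using (Unique; []; _∷_)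
open import Data.List.Relation.Unary.Unique.DecPropositional.Properties _≟_ using (deduplicate-!)
open import Data.Product using (Σ; ∃; ∃₂; _×_; _,_; proj₁; proj₂; uncurry)
open import Data.Product.Properties using (×-≡,≡→≡)
open import Data.Sum using (_⊎_; inj₁; inj₂)
open import Data.Empty using (⊥-elim)
open import Relation.Nullary using (¬_; Dec; yes; no; does)
open import Relation.Nullary.Decidable using (dec-true; dec-false; toWitness; _×-dec_; _⊎-dec_; _→-dec_; ¬?; map′)
open import Relation.Binary.PropositionalEquality
open import Function using (_∘_)
open import Function.Definitions using (Injective; Surjective; Bijective)
open import Data.Vec as Vec using (Vec; []; _∷_)

-- Finite sums

∑-cong : ∀ n {f g : Fin n → ℕ} → (∀ i → f i ≡ g i) → ∑ n f ≡ ∑ n g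
∑-cong zero    eq = refl
∑-cong (suc n) eq = cong₂ _+_ (eq zero) (∑-cong n (eq ∘ suc))

∑-zero : ∀ n → ∑ n (λ _ → 0) ≡ 0
∑-zero zero    = refl
∑-zero (suc n) = ∑-zero n

∑-const : ∀ n c → ∑ n (λ _ → c) ≡ n * c
∑-const zero    c = refl
∑-const (suc n) c = cong (c +_) (∑-const n c)

∑-distrib-+ : ∀ n (f g : Fin n → ℕ) → ∑ n (λ i → f i + g i) ≡ ∑ n f + ∑ n g
∑-distrib-+ zero    f g = refl
∑-distrib-+ (suc n) f g =
  trans (cong (f zero + g zero +_) (∑-distrib-+ n (f ∘ suc) (g ∘ suc)))
        (+-assoc-comm (f zero) (g zero) (∑ n (f ∘ suc)) (∑ n (g ∘ suc)))
  where
  +-assoc-comm : ∀ a b c d → a + b + (c + d) ≡ a + c + (b + d)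
  +-assoc-comm = solve-∀

*-distribˡ-∑ : ∀ n c (f : Fin n → ℕ) → c * ∑ n f ≡ ∑ n (λ i → c * f i)
*-distribˡ-∑ zero    c f = *-zeroʳ c
*-distribˡ-∑ (suc n) c f =
  trans (*-distribˡ-+ c (f zero) _) (cong (c * f zero +_) (*-distribˡ-∑ n c (f ∘ suc)))

∑-↑ : ∀ m n (h : Fin (m + n) → ℕ) →
      ∑ (m + n) h ≡ ∑ m (λ i → h (i ↑ˡ n)) + ∑ n (λ j → h (m ↑ʳ j))
∑-↑ zero    n h = refl
∑-↑ (suc m) n h = trans (cong (h zero +_) (∑-↑ m n (h ∘ suc))) (sym (+-assoc (h zero) _ _))

∑-combine : ∀ m n (h : Fin (m * n) → ℕ) →
            ∑ (m * n) h ≡ ∑ m (λ i → ∑ n (λ j → h (combine i j)))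
∑-combine zero    n h = refl
∑-combine (suc m) n h =
  trans (∑-↑ n (m * n) h) (cong (∑ n (λ j → h (j ↑ˡ (m * n))) +_) (∑-combine m n (λ x → h (n ↑ʳ x))))

∑-comm : ∀ m n (h : Fin m → Fin n → ℕ) → ∑ m (λ i → ∑ n (h i)) ≡ ∑ n (λ j → ∑ m (λ i → h i j))
∑-comm zero    n h = sym (∑-zero n)
∑-comm (suc m) n h =
  trans (cong (∑ n (h zero) +_) (∑-comm m n (h ∘ suc))) (sym (∑-distrib-+ n (h zero) _))

∑-single : ∀ n (i : Fin n) (f : Fin n → ℕ) → (∀ j → j ≢ i → f j ≡ 0) → ∑ n f ≡ f i
∑-single (suc n) zero    f vanish =
  trans (cong (f zero +_) (trans (∑-cong n (λ j → vanish (suc j) λ ())) (∑-zero n)))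
        (+-identityʳ (f zero))
∑-single (suc n) (suc i) f vanish =
  trans (cong (_+ ∑ n (f ∘ suc)) (vanish zero λ ()))
        (∑-single n i (f ∘ suc) (λ j j≢i → vanish (suc j) (j≢i ∘ suc-injectiveᶠ)))

term≤∑ : ∀ n (f : Fin n → ℕ) (i : Fin n) → f i ≤ ∑ n f
term≤∑ (suc n) f zero    = m≤m+n (f zero) _
term≤∑ (suc n) f (suc i) = ≤-trans (term≤∑ n (f ∘ suc) i) (m≤n+m _ (f zero))

∑-punchIn : ∀ n (i : Fin (suc n)) (f : Fin (suc n) → ℕ) → ∑ (suc n) f ≡ f i + ∑ n (f ∘ punchIn i)
∑-punchIn n       zero    f = refl
∑-punchIn (suc n) (suc i) f =
  trans (cong (f zero +_) (∑-punchIn n i (f ∘ suc))) (+-swap (f zero) (f (suc i)) _)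
  where
  +-swap : ∀ x y z → x + (y + z) ≡ y + (x + z)
  +-swap = solve-∀

∑-permute : ∀ n (π : Fin n → Fin n) → Injective _≡_ _≡_ π → ∀ f → ∑ n (f ∘ π) ≡ ∑ n f
∑-permute zero    π π-inj f = refl
∑-permute (suc n) π π-inj f =
  trans (cong (f (π zero) +_) rest) (sym (∑-punchIn n (π zero) f))
  where
  π₀≢ : ∀ i → π zero ≢ π (suc i)
  π₀≢ i eq with () ← π-inj eq
  π′ : Fin n → Fin n
  π′ i = punchOut (π₀≢ i)
  π′-inj : Injective _≡_ _≡_ π′
  π′-inj eq = suc-injectiveᶠ (π-inj (punchOut-injective (π₀≢ _) (π₀≢ _) eq))
  rest : ∑ n (f ∘ π ∘ suc) ≡ ∑ n (f ∘ punchIn (π zero))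
  rest = trans (∑-cong n (λ i → cong f (sym (punchIn-punchOut (π₀≢ i)))))
               (∑-permute n π′ π′-inj (f ∘ punchIn (π zero)))

∑-injective-< : ∀ n (g : Fin n → ℕ) → (∀ i → g i < n) → (∀ {i j} → g i ≡ g j → i ≡ j) → ∑ n g ≡ ∑ n toℕ
∑-injective-< n g g< g-inj =
  trans (∑-cong n (λ i → sym (toℕ-fromℕ< (g< i)))) (∑-permute n π π-inj toℕ)
  where
  π : Fin n → Fin n
  π i = fromℕ< (g< i)
  π-inj : Injective _≡_ _≡_ π
  π-inj {i} {j} eq = g-inj (trans (sym (toℕ-fromℕ< (g< i))) (trans (cong toℕ eq) (toℕ-fromℕ< (g< j))))

2*∑toℕ+n≡n*n : ∀ n → 2 * ∑ n toℕ + n ≡ n * n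
2*∑toℕ+n≡n*n zero    = refl
2*∑toℕ+n≡n*n (suc n) = begin
  2 * ∑ (suc n) toℕ + suc n         ≡⟨ cong (λ s → 2 * s + suc n) ∑toℕ-suc ⟩
  2 * (n + ∑ n toℕ) + suc n         ≡⟨ expand n (∑ n toℕ) ⟩
  (2 * ∑ n toℕ + n) + suc (n + n)   ≡⟨ cong (_+ suc (n + n)) (2*∑toℕ+n≡n*n n) ⟩
  n * n + suc (n + n)               ≡⟨ square-suc n ⟩
  suc n * suc n                     ∎
  where
  open ≡-Reasoning
  ∑toℕ-suc : ∑ (suc n) toℕ ≡ n + ∑ n toℕ
  ∑toℕ-suc = trans (∑-distrib-+ n (λ _ → 1) toℕ) (cong (_+ ∑ n toℕ) (trans (∑-const n 1) (*-identityʳ n)))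
  expand : ∀ n s → 2 * (n + s) + suc n ≡ (2 * s + n) + suc (n + n)
  expand = solve-∀
  square-suc : ∀ n → n * n + suc (n + n) ≡ suc n * suc n
  square-suc = solve-∀

injective⇒surjective : ∀ n (π : Fin n → Fin n) → Injective _≡_ _≡_ π → Surjective _≡_ _≡_ π
injective⇒surjective (suc n) π π-inj y with any? (λ x → π x ≟ᶠ y)
... | yes (x , πx≡y) = x , λ { refl → πx≡y }
... | no ∄x = ⊥-elim (1+n≰n (injective⇒≤ π′-inj))
  where
  y≢π : ∀ x → y ≢ π x
  y≢π x eq = ∄x (x , sym eq)
  π′ : Fin (suc n) → Fin n
  π′ x = punchOut (y≢π x)
  π′-inj : Injective _≡_ _≡_ π′
  π′-inj eq = π-inj (punchOut-injective (y≢π _) (y≢π _) eq)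

remQuot-injective : ∀ {m} n {x y : Fin (m * n)} → remQuot {m} n x ≡ remQuot n y → x ≡ y
remQuot-injective {m} n {x} {y} eq =
  trans (sym (combine-remQuot {m} n x)) (trans (cong (uncurry combine) eq) (combine-remQuot {m} n y))

∑-if : ∀ n c (g : Fin n → ℕ) → ∑ n (λ j → if c then g j else 0) ≡ (if c then ∑ n g else 0)
∑-if n true  g = refl
∑-if n false g = ∑-zero n

∑-indicator : ∀ n (i : Fin n) (g : Fin n → ℕ) → ∑ n (λ j → if does (i ≟ᶠ j) then g j else 0) ≡ g i
∑-indicator n i g = trans (∑-single n i _ off-i) (cong (λ c → if c then g i else 0) (dec-true (i ≟ᶠ i) refl))
  where
  off-i : ∀ j → j ≢ i → (if does (i ≟ᶠ j) then g j else 0) ≡ 0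
  off-i j j≢i = cong (λ c → if c then g j else 0) (dec-false (i ≟ᶠ j) (j≢i ∘ sym))

-- Counting values

Unique⇒length≤ : ∀ (xs ys : List ℕ) → Unique xs → (∀ {z} → z ∈ xs → z ∈ ys) → length xs ≤ length ys
Unique⇒length≤ []       ys _          _  = z≤n
Unique⇒length≤ (x ∷ xs) ys (x∉ ∷ xs!) xs⊆ys =
  subst (suc (length xs) ≤_) (sym (length-remove x∈ys))
        (s≤s (Unique⇒length≤ xs (remove x∈ys) xs! xs⊆ys-x))
  where
  remove : ∀ {x : ℕ} {ys} → x ∈ ys → List ℕ
  remove {ys = y ∷ ys} (here _)  = ys
  remove {ys = y ∷ ys} (there p) = y ∷ remove p
  length-remove : ∀ {x : ℕ} {ys} (p : x ∈ ys) → length ys ≡ suc (length (remove p))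
  length-remove {ys = y ∷ ys} (here _)  = refl
  length-remove {ys = y ∷ ys} (there p) = cong suc (length-remove p)
  ∈-remove : ∀ {x z : ℕ} {ys} (p : x ∈ ys) → z ∈ ys → z ≢ x → z ∈ remove p
  ∈-remove (here refl) (here refl) z≢x = ⊥-elim (z≢x refl)
  ∈-remove (here _)    (there q)   _   = q
  ∈-remove (there p)   (here e)    _   = here e
  ∈-remove (there p)   (there q)   z≢x = there (∈-remove p q z≢x)
  x∈ys : x ∈ ys
  x∈ys = xs⊆ys (here refl)
  xs⊆ys-x : ∀ {z} → z ∈ xs → z ∈ remove x∈ys
  xs⊆ys-x z∈xs = ∈-remove x∈ys (xs⊆ys (there z∈xs)) (λ z≡x → All.lookup x∉ z∈xs (sym z≡x))

module _ {V : ℕ} (h : Fin V → ℕ) where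

  values : List ℕ
  values = deduplicate _≟_ (map h (allFin V))

  values-unique : Unique values
  values-unique = deduplicate-! (map h (allFin V))

  ∈-values : ∀ u → h u ∈ values
  ∈-values u = ∈-deduplicate⁺ _≟_ (∈-map⁺ h (∈-allFin u))

  values-∈ : ∀ {z} → z ∈ values → ∃ λ u → z ≡ h u
  values-∈ z∈ with u , _ , z≡hu ← ∈-map⁻ h (∈-deduplicate⁻ _≟_ (map h (allFin V)) z∈) = u , z≡hu

  valueColoring : Fin V → Fin (numValues h)
  valueColoring u = index (∈-values u)

  valueColoring-reflects : ∀ u v → valueColoring u ≡ valueColoring v → h u ≡ h v
  valueColoring-reflects u v eq =
    trans (lookup-index (∈-values u)) (trans (cong (lookup values) eq) (sym (lookup-index (∈-values v))))

  2≤numValues : ∀ u v → h u ≢ h v → 2 ≤ numValues h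
  2≤numValues u v hu≢hv = Unique⇒length≤ (h u ∷ h v ∷ []) values ((hu≢hv ∷ []) ∷ [] ∷ []) ⊆values
    where
    ⊆values : ∀ {z} → z ∈ h u ∷ h v ∷ [] → z ∈ values
    ⊆values (here refl)         = ∈-values u
    ⊆values (there (here refl)) = ∈-values v

  numValues≡2⇒twoValued : numValues h ≡ 2 → ∃₂ λ s t → ∀ u → h u ≡ s ⊎ h u ≡ t
  numValues≡2⇒twoValued _ with values | ∈-values
  ... | s ∷ t ∷ [] | ∈st = s , t , λ u → twoCases (∈st u)
    where
    twoCases : ∀ {z} → z ∈ s ∷ t ∷ [] → z ≡ s ⊎ z ≡ t
    twoCases (here z≡s)         = inj₁ z≡s
    twoCases (there (here z≡t)) = inj₂ z≡t

numValues-≤-factor : ∀ {A B} (h : Fin A → ℕ) (h′ : Fin B → ℕ) (π : Fin B → Fin A) →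
                     (∀ w w′ → h (π w) ≡ h (π w′) → h′ w ≡ h′ w′) → numValues h′ ≤ numValues h
numValues-≤-factor {A} {B} h h′ π factors =
  subst (numValues h′ ≤_) (length-map Φ (values h))
        (Unique⇒length≤ (values h′) (map Φ (values h)) (values-unique h′) ⊆Φvalues)
  where
  Φ : ℕ → ℕ
  Φ s with any? (λ w → h (π w) ≟ s)
  ... | yes (w , _) = h′ w
  ... | no _        = 0
  Φ-factors : ∀ w → Φ (h (π w)) ≡ h′ w
  Φ-factors w with any? (λ w′ → h (π w′) ≟ h (π w))
  ... | yes (w′ , eq) = factors w′ w eq
  ... | no ∄w′        = ⊥-elim (∄w′ (w , refl))
  ⊆Φvalues : ∀ {z} → z ∈ values h′ → z ∈ map Φ (values h)
  ⊆Φvalues z∈ with w , refl ← values-∈ h′ z∈ =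
    subst (_∈ map Φ (values h)) (Φ-factors w) (∈-map⁺ Φ (∈-values h (π w)))

2≤numValues⇒nonconstant : ∀ {V} (h : Fin V → ℕ) → 2 ≤ numValues h → ∃₂ λ u v → h u ≢ h v
2≤numValues⇒nonconstant {V} h 2≤ with all? (λ u → all? (λ v → h u ≟ h v))
... | yes constant =
  ⊥-elim (<⇒≱ 2≤ (numValues-≤-factor {1} (λ _ → 0) h (λ _ → zero) (λ w w′ _ → constant w w′)))
... | no ¬constant with u , ¬allᵤ ← ¬∀⟶∃¬ V _ (λ u → all? (λ v → h u ≟ h v)) ¬constant
                   with v , hu≢hv ← ¬∀⟶∃¬ V _ (λ v → h u ≟ h v) ¬allᵤ = u , v , hu≢hv

-- Labelings realising χ_la

least : (P : ℕ → Set) → (∀ m → Dec (P m)) → ∀ c → P c → ∃ λ m → P m × (∀ j → P j → m ≤ j)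
least P P? c Pc = search c 0 (λ _ ()) Pc
  where
  search : ∀ fuel t → (∀ j → j < t → ¬ P j) → P (t + fuel) → ∃ λ m → P m × (∀ j → P j → m ≤ j)
  search fuel t below Pt+fuel with P? t
  ... | yes Pt = t , Pt , λ j Pj → ≮⇒≥ (λ j<t → below j j<t Pj)
  search zero    t below Pt+0 | no ¬Pt = ⊥-elim (¬Pt (subst P (+-identityʳ t) Pt+0))
  search (suc f) t below Pt+f | no ¬Pt = search f (suc t) below′ (subst P (+-suc t f) Pt+f)
    where
    below′ : ∀ j → j < suc t → ¬ P j
    below′ j j<1+t with m≤n⇒m<n∨m≡n (≤-pred j<1+t)
    ... | inj₁ j<t  = below j j<t
    ... | inj₂ refl = ¬Pt

∃-function? : ∀ d N (P : (Fin d → Fin N) → Set) → (∀ g h → (∀ x → g x ≡ h x) → P g → P h) →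
              (∀ g → Dec (P g)) → Dec (∃ P)
∃-function? zero N P resp P? with P? (λ ())
... | yes Pg = yes (_ , Pg)
... | no ¬Pg = no λ (g , Pg) → ¬Pg (resp g _ (λ ()) Pg)
∃-function? (suc d) N P resp P?
  with any? (λ b → ∃-function? d N (P ∘ cons b) (λ g h eq → resp _ _ (cons-cong b eq)) (P? ∘ cons b))
  where
  cons : Fin N → (Fin d → Fin N) → Fin (suc d) → Fin N
  cons b g zero    = b
  cons b g (suc x) = g x
  cons-cong : ∀ b {g h} → (∀ x → g x ≡ h x) → ∀ x → cons b g x ≡ cons b h x
  cons-cong b eq zero    = refl
  cons-cong b eq (suc x) = eq x
... | yes (_ , _ , Pg) = yes (_ , Pg)
... | no ¬P = no λ (g , Pg) → ¬P (g zero , g ∘ suc , resp g _ (λ { zero → refl ; (suc x) → refl }) Pg)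

module _ (H : Graph) where

  Adj? : ∀ u v → Dec (Adj H u v)
  Adj? u v = any? (λ e → sameEnds? (ends H e) (u , v))
    where
    sameEnds? : ∀ {V} (p r : Fin V × Fin V) → Dec (SameEnds p r)
    sameEnds? (a , b) (c , d) = ((a ≟ᶠ c) ×-dec (b ≟ᶠ d)) ⊎-dec ((a ≟ᶠ d) ×-dec (b ≟ᶠ c))

  bijective? : (g : Fin (q H) → Fin (q H)) → Dec (Bijective _≡_ _≡_ g)
  bijective? g =
    map′ (λ inj {x} {y} → inj x y) (λ inj x y → inj) (all? λ x → all? λ y → (g x ≟ᶠ g y) →-dec (x ≟ᶠ y))
    ×-dec
    map′ (λ sur y → proj₁ (sur y) , λ { refl → proj₂ (sur y) }) (λ sur y → proj₁ (sur y) , proj₂ (sur y) refl)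
         (all? λ y → any? λ x → g x ≟ᶠ y)

  AntimagicLabelingWith : ℕ → (Fin (q H) → Fin (q H)) → Set
  AntimagicLabelingWith m g = Σ (Bijective _≡_ _≡_ g) λ b →
    IsLocalAntimagic H (mkLabeling g b) × colorsOf H (mkLabeling g b) ≡ m

  AntimagicLabelingWith? : ∀ m g → Dec (AntimagicLabelingWith m g)
  AntimagicLabelingWith? m g with bijective? g
  ... | no ¬b = no (¬b ∘ proj₁)
  ... | yes b = map′ (b ,_) (λ (_ , la , c) → la , c) (antimagic? ×-dec (colorsOf H (mkLabeling g b) ≟ m))
    where
    antimagic? : Dec (IsLocalAntimagic H (mkLabeling g b))
    antimagic? = all? λ u → all? λ v → Adj? u v →-dec ¬? (vsum H (mkLabeling g b) u ≟ vsum H (mkLabeling g b) v)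

  AntimagicLabelingWith-resp : ∀ m g h → (∀ x → g x ≡ h x) → AntimagicLabelingWith m g → AntimagicLabelingWith m h
  AntimagicLabelingWith-resp m g h g≗h ((g-inj , g-sur) , la , c) = (h-inj , h-sur) , la′ , trans (sym same-colors) c
    where
    h-inj : Injective _≡_ _≡_ h
    h-inj {x} {y} eq = g-inj (trans (g≗h x) (trans eq (sym (g≗h y))))
    h-sur : Surjective _≡_ _≡_ h
    h-sur y = proj₁ (g-sur y) , λ {z} z≡x → trans (sym (g≗h z)) (proj₂ (g-sur y) z≡x)
    same-vsum : ∀ u → vsum H (mkLabeling g (g-inj , g-sur)) u ≡ vsum H (mkLabeling h (h-inj , h-sur)) u
    same-vsum u = ∑-cong (q H) (λ x → cong (λ y → if incident H u x then suc (toℕ y) else 0) (g≗h x))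
    la′ : IsLocalAntimagic H (mkLabeling h (h-inj , h-sur))
    la′ u v adj eq = la u v adj (trans (same-vsum u) (trans eq (sym (same-vsum v))))
    same-colors : colorsOf H (mkLabeling g (g-inj , g-sur)) ≡ colorsOf H (mkLabeling h (h-inj , h-sur))
    same-colors = cong (length ∘ deduplicate _≟_) (map-cong same-vsum (allFin (V H)))

  χla-exists : (f : Labeling H) → IsLocalAntimagic H f → Σ ℕ (IsChiLa H)
  χla-exists f la
    with m , (g , b , la′ , c) , minimal ←
         least (λ m → ∃ (AntimagicLabelingWith m))
               (λ m → ∃-function? (q H) (q H) (AntimagicLabelingWith m) (AntimagicLabelingWith-resp m) (AntimagicLabelingWith? m))
               (colorsOf H f) (lab f , bij f , la , refl)
    = m , (mkLabeling g b , la′ , c) , λ f′ la-f′ → minimal _ (lab f′ , bij f′ , la-f′ , refl)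

-- Base-n digits and residues

base-digits-unique : ∀ k .{{_ : NonZero k}} {s s′ t t′} → t < k → t′ < k →
                     k * s + t ≡ k * s′ + t′ → s ≡ s′ × t ≡ t′
base-digits-unique k {s} {s′} {t} {t′} t<k t′<k eq = *-cancelˡ-≡ s s′ k (+-cancelʳ-≡ _ _ _ eq′) , t≡t′
  where
  remainder : ∀ s t → t < k → (k * s + t) % k ≡ t
  remainder s t t<k =
    trans (%-congˡ (trans (+-comm (k * s) t) (cong (t +_) (*-comm k s))))
          (trans ([m+kn]%n≡m%n t s k) (m<n⇒m%n≡m t<k))
  t≡t′ : t ≡ t′
  t≡t′ = trans (sym (remainder s t t<k)) (trans (%-congˡ eq) (remainder s′ t′ t′<k))
  eq′ : k * s + t ≡ k * s′ + t
  eq′ = trans eq (cong (k * s′ +_) (sym t≡t′))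

digits< : ∀ k {m s t} → s < m → t < k → k * s + t < k * m
digits< k {m} {s} {t} s<m t<k = begin-strict
  k * s + t     <⟨ +-monoʳ-< (k * s) t<k ⟩
  k * s + k     ≡⟨ trans (+-comm (k * s) k) (sym (*-suc k s)) ⟩
  k * suc s     ≤⟨ *-monoʳ-≤ k s<m ⟩
  k * m         ∎
  where open ≤-Reasoning

%-cancelˡ-+ : ∀ n .{{_ : NonZero n}} c x y → (c + x) % n ≡ (c + y) % n → x % n ≡ y % n
%-cancelˡ-+ n c x y eq = trans (via x) (trans (cong (λ r → (d % n + r) % n) eq) (sym (via y)))
  where
  -- Adding d = n ∸ c % n to c gives a multiple of n.
  d = n ∸ c % n
  via : ∀ z → z % n ≡ (d % n + (c + z) % n) % n
  via z = begin
    z % n                         ≡⟨ [m+kn]%n≡m%n z (suc (c / n)) n ⟨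
    (z + suc (c / n) * n) % n     ≡⟨ %-congˡ (cong (λ w → z + (w + c / n * n)) (m∸n+n≡m (m%n≤n c n))) ⟨
    (z + ((d + c % n) + c / n * n)) % n ≡⟨ %-congˡ (rearrange z d (c % n) (c / n * n)) ⟩
    (d + (c % n + c / n * n + z)) % n ≡⟨ %-congˡ (cong (λ w → d + (w + z)) (m≡m%n+[m/n]*n c n)) ⟨
    (d + (c + z)) % n             ≡⟨ %-distribˡ-+ d (c + z) n ⟩
    (d % n + (c + z) % n) % n     ∎
    where
    open ≡-Reasoning
    rearrange : ∀ z d r s → z + ((d + r) + s) ≡ d + (r + s + z)
    rearrange = solve-∀

%-cancel-double : ∀ t x y → (x + x) % suc (t * 2) ≡ (y + y) % suc (t * 2) → x % suc (t * 2) ≡ y % suc (t * 2)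
%-cancel-double t x y eq = trans (via x) (trans (cong (λ r → (suc t % n * r) % n) eq) (sym (via y)))
  where
  -- 1 + t is the inverse of 2 modulo the odd number n = 1 + 2t.
  n = suc (t * 2)
  via : ∀ z → z % n ≡ (suc t % n * ((z + z) % n)) % n
  via z = begin
    z % n                           ≡⟨ [m+kn]%n≡m%n z z n ⟨
    (z + z * n) % n                 ≡⟨ %-congˡ (inverse z t) ⟩
    (suc t * (z + z)) % n           ≡⟨ %-distribˡ-* (suc t) (z + z) n ⟩
    (suc t % n * ((z + z) % n)) % n ∎
    where
    open ≡-Reasoning
    inverse : ∀ z t → z + z * suc (t * 2) ≡ suc t * (z + z)
    inverse = solve-∀

-- Semi-magic squares

record SemiMagicSquare (n : ℕ) : Set where
  field
    entry           : Fin n → Fin n → ℕ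
    entry<          : ∀ i j → entry i j < n * n
    entry-injective : ∀ {i j i′ j′} → entry i j ≡ entry i′ j′ → i ≡ i′ × j ≡ j′
    lineSum         : ℕ
    rowSum          : ∀ i → ∑ n (entry i) ≡ lineSum
    columnSum       : ∀ j → ∑ n (λ i → entry i j) ≡ lineSum

  magicConstant : .{{NonZero n}} → 2 * lineSum + n ≡ n ^ 3
  magicConstant = *-cancelˡ-≡ _ _ n (begin
    n * (2 * lineSum + n)              ≡⟨ expand n lineSum ⟩
    2 * (n * lineSum) + n * n          ≡⟨ cong (λ s → 2 * s + n * n) total ⟩
    2 * ∑ (n * n) toℕ + n * n          ≡⟨ 2*∑toℕ+n≡n*n (n * n) ⟩
    n * n * (n * n)                    ≡⟨ fourth-power n ⟩
    n * n ^ 3                          ∎)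
    where
    open ≡-Reasoning
    expand : ∀ n s → n * (2 * s + n) ≡ 2 * (n * s) + n * n
    expand = solve-∀
    fourth-power : ∀ n → n * n * (n * n) ≡ n * (n * (n * (n * 1)))
    fourth-power = solve-∀
    entryAt : Fin (n * n) → ℕ
    entryAt x = entry (proj₁ (remQuot {n} n x)) (proj₂ (remQuot {n} n x))
    total : n * lineSum ≡ ∑ (n * n) toℕ
    total = begin
      n * lineSum                        ≡⟨ ∑-const n lineSum ⟨
      ∑ n (λ _ → lineSum)                ≡⟨ ∑-cong n rowSum ⟨
      ∑ n (λ i → ∑ n (entry i))          ≡⟨ ∑-cong n (λ i → ∑-cong n (λ j → cong (λ (i , j) → entry i j) (remQuot-combine {n} i j))) ⟨
      ∑ n (λ i → ∑ n (λ j → entryAt (combine i j))) ≡⟨ ∑-combine n n entryAt ⟨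
      ∑ (n * n) entryAt                  ≡⟨ ∑-injective-< (n * n) entryAt (λ x → entry< _ _) entryAt-injective ⟩
      ∑ (n * n) toℕ                      ∎
      where
      entryAt-injective : ∀ {x y} → entryAt x ≡ entryAt y → x ≡ y
      entryAt-injective eq = remQuot-injective {n} n (×-≡,≡→≡ (entry-injective eq))

module OddSquare (t : ℕ) where

  private
    n : ℕ
    n = suc (t * 2)

    toℕ-% : ∀ (x : Fin n) → toℕ x % n ≡ toℕ x
    toℕ-% x = m<n⇒m%n≡m (toℕ<n x)

    shift-injective : ∀ c {x y : Fin n} → (c + toℕ x) % n ≡ (c + toℕ y) % n → x ≡ y
    shift-injective c {x} {y} eq =
      toℕ-injective (trans (sym (toℕ-% x)) (trans (%-cancelˡ-+ n c _ _ eq) (toℕ-% y)))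

    double-injective : ∀ c {x y : Fin n} → (c + (toℕ x + toℕ x)) % n ≡ (c + (toℕ y + toℕ y)) % n → x ≡ y
    double-injective c {x} {y} eq =
      toℕ-injective (trans (sym (toℕ-% x)) (trans (%-cancel-double t (toℕ x) (toℕ y) (%-cancelˡ-+ n c _ _ eq)) (toℕ-% y)))

    -- Two orthogonal Latin squares, used as the base-n digits of the entries.
    high low : Fin n → Fin n → ℕ
    high i j = (toℕ i + toℕ j) % n
    low  i j = (toℕ i + (toℕ j + toℕ j)) % n

    high< : ∀ i j → high i j < n
    high< i j = m%n<n (toℕ i + toℕ j) n
    low< : ∀ i j → low i j < n
    low< i j = m%n<n (toℕ i + (toℕ j + toℕ j)) n

    low≡high+j : ∀ i j → low i j ≡ (high i j + toℕ j) % n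
    low≡high+j i j = begin
      (toℕ i + (toℕ j + toℕ j)) % n          ≡⟨ %-congˡ (+-assoc (toℕ i) (toℕ j) (toℕ j)) ⟨
      (toℕ i + toℕ j + toℕ j) % n            ≡⟨ %-distribˡ-+ (toℕ i + toℕ j) (toℕ j) n ⟩
      (high i j + toℕ j % n) % n             ≡⟨ cong (λ r → (r + toℕ j % n) % n) (m%n%n≡m%n (toℕ i + toℕ j) n) ⟨
      (high i j % n + toℕ j % n) % n         ≡⟨ %-distribˡ-+ (high i j) (toℕ j) n ⟨
      (high i j + toℕ j) % n                 ∎
      where open ≡-Reasoning

    high-columnInjective : ∀ j {i i′} → high i j ≡ high i′ j → i ≡ i′
    high-columnInjective j {i} {i′} eq = shift-injective (toℕ j)
      (trans (%-congˡ (+-comm (toℕ j) (toℕ i))) (trans eq (%-congˡ (+-comm (toℕ i′) (toℕ j)))))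

    low-columnInjective : ∀ j {i i′} → low i j ≡ low i′ j → i ≡ i′
    low-columnInjective j {i} {i′} eq = shift-injective (toℕ j + toℕ j)
      (trans (%-congˡ (+-comm (toℕ j + toℕ j) (toℕ i))) (trans eq (%-congˡ (+-comm (toℕ i′) _))))

    entry : Fin n → Fin n → ℕ
    entry i j = n * high i j + low i j

    entry-injective : ∀ {i j i′ j′} → entry i j ≡ entry i′ j′ → i ≡ i′ × j ≡ j′
    entry-injective {i} {j} {i′} {j′} eq
      with high≡ , low≡ ← base-digits-unique n (low< i j) (low< i′ j′) eq = i≡i′ , j≡j′
      where
      j≡j′ : j ≡ j′
      j≡j′ = shift-injective (high i j)
        (trans (sym (low≡high+j i j)) (trans low≡ (trans (low≡high+j i′ j′) (cong (λ h → (h + toℕ j′) % n) (sym high≡)))))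
      i≡i′ : i ≡ i′
      i≡i′ = high-columnInjective j (trans high≡ (cong (high i′) (sym j≡j′)))

    digitSum : ∀ (f g : Fin n → ℕ) → ∑ n f ≡ ∑ n toℕ → ∑ n g ≡ ∑ n toℕ →
               ∑ n (λ x → n * f x + g x) ≡ n * ∑ n toℕ + ∑ n toℕ
    digitSum f g ∑f ∑g =
      trans (∑-distrib-+ n (λ x → n * f x) g)
            (cong₂ _+_ (trans (sym (*-distribˡ-∑ n n f)) (cong (n *_) ∑f)) ∑g)

  oddSquare : SemiMagicSquare (suc (t * 2))
  oddSquare = record
    { entry           = entry
    ; entry<          = λ i j → digits< n (high< i j) (low< i j)
    ; entry-injective = entry-injective
    ; lineSum         = n * ∑ n toℕ + ∑ n toℕ
    ; rowSum          = λ i → digitSum (high i) (low i)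
        (∑-injective-< n (high i) (high< i) (shift-injective (toℕ i)))
        (∑-injective-< n (low i) (low< i) (double-injective (toℕ i)))
    ; columnSum       = λ j → digitSum (λ i → high i j) (λ i → low i j)
        (∑-injective-< n (λ i → high i j) (λ i → high< i j) (high-columnInjective j))
        (∑-injective-< n (λ i → low i j) (λ i → low< i j) (low-columnInjective j))
    }

order4Square : SemiMagicSquare 4
order4Square = record
  { entry           = entry
  ; entry<          = toWitness {a? = all? λ i → all? λ j → entry i j <? 16} _
  ; entry-injective = λ {i} {j} {i′} {j′} → toWitness {a? = injective?} _ i j i′ j′
  ; lineSum         = 30
  ; rowSum          = toWitness {a? = all? λ i → ∑ 4 (entry i) ≟ 30} _
  ; columnSum       = toWitness {a? = all? λ j → ∑ 4 (λ i → entry i j) ≟ 30} _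
  }
  where
  entry : Fin 4 → Fin 4 → ℕ
  entry i j = Vec.lookup (Vec.lookup table i) j
    where
    table : Vec (Vec ℕ 4) 4
    table = ( 0 ∷  7 ∷  9 ∷ 14 ∷ [])
          ∷ (11 ∷ 12 ∷  2 ∷  5 ∷ [])
          ∷ ( 6 ∷  1 ∷ 15 ∷  8 ∷ [])
          ∷ (13 ∷ 10 ∷  4 ∷  3 ∷ [])
          ∷ []
  injective? : Dec (∀ i j i′ j′ → entry i j ≡ entry i′ j′ → i ≡ i′ × j ≡ j′)
  injective? = all? λ i → all? λ j → all? λ i′ → all? λ j′ →
    (entry i j ≟ entry i′ j′) →-dec ((i ≟ᶠ i′) ×-dec (j ≟ᶠ j′))

-- 2 × 2 arrangements of 0, 1, 2, 3 whose rows both sum to 3, named by their column sums.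
data BlockKind : Set where
  cols24 cols42 cols51 : BlockKind

block : BlockKind → Fin 2 → Fin 2 → ℕ
block k a b = Vec.lookup (Vec.lookup (rows k) a) b
  where
  rows : BlockKind → Vec (Vec ℕ 2) 2
  rows cols24 = (0 ∷ 3 ∷ []) ∷ (2 ∷ 1 ∷ []) ∷ []
  rows cols42 = (3 ∷ 0 ∷ []) ∷ (1 ∷ 2 ∷ []) ∷ []
  rows cols51 = (3 ∷ 0 ∷ []) ∷ (2 ∷ 1 ∷ []) ∷ []

blockColumnSum : BlockKind → Fin 2 → ℕ
blockColumnSum k b = ∑ 2 (λ a → block k a b)

private
  ∀-kind? : {P : BlockKind → Set} → (∀ k → Dec (P k)) → Dec (∀ k → P k)
  ∀-kind? P? = map′ (λ (p₂₄ , p₄₂ , p₅₁) → λ { cols24 → p₂₄ ; cols42 → p₄₂ ; cols51 → p₅₁ })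
                    (λ p → p cols24 , p cols42 , p cols51)
                    (P? cols24 ×-dec P? cols42 ×-dec P? cols51)

block< : ∀ k a b → block k a b < 4
block< = toWitness {a? = ∀-kind? λ k → all? λ a → all? λ b → block k a b <? 4} _

blockRowSum : ∀ k a → ∑ 2 (block k a) ≡ 3
blockRowSum = toWitness {a? = ∀-kind? λ k → all? λ a → ∑ 2 (block k a) ≟ 3} _

block-injective : ∀ k {a b a′ b′} → block k a b ≡ block k a′ b′ → a ≡ a′ × b ≡ b′
block-injective k {a} {b} {a′} {b′} = toWitness {a? = injective?} _ k a b a′ b′
  where
  injective? : Dec (∀ k a b a′ b′ → block k a b ≡ block k a′ b′ → a ≡ a′ × b ≡ b′)
  injective? = ∀-kind? λ k → all? λ a → all? λ b → all? λ a′ → all? λ b′ →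
    (block k a b ≟ block k a′ b′) →-dec ((a ≟ᶠ a′) ×-dec (b ≟ᶠ b′))

record BlockPattern (m : ℕ) : Set where
  field
    kind     : Fin m → BlockKind
    balanced : ∀ b → ∑ m (λ i → blockColumnSum (kind i) b) ≡ m * 3

∑-period2 : ∀ t (h : ℕ → ℕ) → (∀ k → h (2 + k) ≡ h k) → ∑ (t * 2) (h ∘ toℕ) ≡ t * (h 0 + h 1)
∑-period2 zero    h periodic = refl
∑-period2 (suc t) h periodic =
  trans (sym (+-assoc (h 0) (h 1) _))
        (cong (h 0 + h 1 +_) (trans (∑-cong (t * 2) (periodic ∘ toℕ)) (∑-period2 t h periodic)))

alternating : ℕ → BlockKind
alternating zero          = cols24
alternating (suc zero)    = cols42
alternating (suc (suc k)) = alternating k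

evenPattern : ∀ t → BlockPattern (t * 2)
evenPattern t = record { kind = alternating ∘ toℕ ; balanced = balanced }
  where
  balanced : ∀ b → ∑ (t * 2) (λ i → blockColumnSum (alternating (toℕ i)) b) ≡ t * 2 * 3
  balanced b = trans (∑-period2 t (λ k → blockColumnSum (alternating k) b) (λ _ → refl)) (total b t)
    where
    total : ∀ b t → t * (blockColumnSum cols24 b + blockColumnSum cols42 b) ≡ t * 2 * 3
    total zero       = solve-∀
    total (suc zero) = solve-∀

oddPattern : ∀ t → BlockPattern (3 + t * 2)
oddPattern t = record { kind = kind ; balanced = balanced }
  where
  kind : Fin (3 + t * 2) → BlockKind
  kind zero                = cols51
  kind (suc zero)          = cols24
  kind (suc (suc zero))    = cols24
  kind (suc (suc (suc i))) = alternating (suc (toℕ i))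
  balanced : ∀ b → ∑ (3 + t * 2) (λ i → blockColumnSum (kind i) b) ≡ (3 + t * 2) * 3
  balanced b =
    trans (cong (λ s → c cols51 + (c cols24 + (c cols24 + s)))
                (∑-period2 t (λ k → c (alternating (suc k))) (λ _ → refl)))
          (total b t)
    where
    c : BlockKind → ℕ
    c k = blockColumnSum k b
    total : ∀ b t → blockColumnSum cols51 b + (blockColumnSum cols24 b + (blockColumnSum cols24 b
                      + t * (blockColumnSum cols42 b + blockColumnSum cols24 b))) ≡ (3 + t * 2) * 3
    total zero       = solve-∀
    total (suc zero) = solve-∀

data ParityView : ℕ → Set where
  even : ∀ t → ParityView (t * 2)
  odd  : ∀ t → ParityView (suc (t * 2))

parityView : ∀ n → ParityView n
parityView zero    = even 0
parityView (suc n) with parityView n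
... | even t = odd t
... | odd t  = even (suc t)

blockPattern : ∀ m → 3 ≤ m → BlockPattern m
blockPattern m = byParity (parityView m)
  where
  byParity : ∀ {m} → ParityView m → 3 ≤ m → BlockPattern m
  byParity (even t)       _              = evenPattern t
  byParity (odd zero)     (s≤s ())
  byParity (odd (suc t))  _              = oddPattern t

module Doubling {m} (S : SemiMagicSquare m) (P : BlockPattern m) where

  private
    module S = SemiMagicSquare S
    open BlockPattern P

    entry′ : Fin m × Fin 2 → Fin m × Fin 2 → ℕ
    entry′ (i , a) (j , b) = 4 * S.entry i j + block (kind i) a b

    entry : Fin (m * 2) → Fin (m * 2) → ℕ
    entry x y = entry′ (remQuot 2 x) (remQuot 2 y)

    entry< : ∀ x y → entry x y < m * 2 * (m * 2)
    entry< x y = subst (entry x y <_) (square-double m)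
                       (digits< 4 (S.entry< _ _) (block< (kind (proj₁ (remQuot 2 x))) _ _))
      where
      square-double : ∀ m → 4 * (m * m) ≡ m * 2 * (m * 2)
      square-double = solve-∀

    entry′-injective : ∀ {p q p′ q′} → entry′ p q ≡ entry′ p′ q′ → p ≡ p′ × q ≡ q′
    entry′-injective {i , a} {j , b} {i′ , a′} {j′ , b′} eq
      with entry≡ , block≡ ← base-digits-unique 4 (block< (kind i) a b) (block< (kind i′) a′ b′) eq
      with refl , refl ← S.entry-injective entry≡
      with refl , refl ← block-injective (kind i) block≡
      = refl , refl

    entry-injective : ∀ {x y x′ y′} → entry x y ≡ entry x′ y′ → x ≡ x′ × y ≡ y′
    entry-injective eq with row≡ , column≡ ← entry′-injective eq =
      remQuot-injective 2 row≡ , remQuot-injective 2 column≡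

    ∑-halves : ∀ (h : Fin m × Fin 2 → ℕ) → ∑ (m * 2) (h ∘ remQuot 2) ≡ ∑ m (λ i → ∑ 2 (λ a → h (i , a)))
    ∑-halves h = trans (∑-combine m 2 _) (∑-cong m λ i → ∑-cong 2 λ a → cong h (remQuot-combine i a))

    ∑-block : ∀ (f : Fin 2 → ℕ) s → ∑ 2 (λ a → 4 * s + f a) ≡ 8 * s + ∑ 2 f
    ∑-block f s = regroup s (f zero) (f (suc zero))
      where
      regroup : ∀ s x y → 4 * s + x + (4 * s + y + 0) ≡ 8 * s + (x + (y + 0))
      regroup = solve-∀

    lineSum : ℕ
    lineSum = 8 * S.lineSum + m * 3

    ∑-8*+ : ∀ (g h : Fin m → ℕ) → ∑ m g ≡ S.lineSum → ∑ m h ≡ m * 3 → ∑ m (λ i → 8 * g i + h i) ≡ lineSum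
    ∑-8*+ g h ∑g ∑h =
      trans (∑-distrib-+ m (λ i → 8 * g i) h) (cong₂ _+_ (trans (sym (*-distribˡ-∑ m 8 g)) (cong (8 *_) ∑g)) ∑h)

    rowSum : ∀ x → ∑ (m * 2) (entry x) ≡ lineSum
    rowSum x = trans (∑-halves (entry′ (remQuot 2 x))) (rowSum′ (remQuot 2 x))
      where
      rowSum′ : ∀ p → ∑ m (λ j → ∑ 2 (λ b → entry′ p (j , b))) ≡ lineSum
      rowSum′ (i , a) = trans (∑-cong m λ j → trans (∑-block (block (kind i) a) (S.entry i j))
                                                    (cong (8 * S.entry i j +_) (blockRowSum (kind i) a)))
                              (∑-8*+ (S.entry i) (λ _ → 3) (S.rowSum i) (∑-const m 3))

    columnSum : ∀ y → ∑ (m * 2) (λ x → entry x y) ≡ lineSum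
    columnSum y = trans (∑-halves (λ p → entry′ p (remQuot 2 y))) (columnSum′ (remQuot 2 y))
      where
      columnSum′ : ∀ p → ∑ m (λ i → ∑ 2 (λ a → entry′ (i , a) p)) ≡ lineSum
      columnSum′ (j , b) = trans (∑-cong m λ i → ∑-block (λ a → block (kind i) a b) (S.entry i j))
                                 (∑-8*+ (λ i → S.entry i j) (λ i → blockColumnSum (kind i) b) (S.columnSum j) (balanced b))

  doubledSquare : SemiMagicSquare (m * 2)
  doubledSquare = record
    { entry = entry ; entry< = entry< ; entry-injective = entry-injective
    ; lineSum = lineSum ; rowSum = rowSum ; columnSum = columnSum }

semiMagicSquare : ∀ n → 3 ≤ n → SemiMagicSquare n
semiMagicSquare = <-rec (λ n → 3 ≤ n → SemiMagicSquare n) λ n smaller → byParity (parityView n) smaller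
  where
  byParity : ∀ {n} → ParityView n → (∀ {m} → m < n → 3 ≤ m → SemiMagicSquare m) → 3 ≤ n → SemiMagicSquare n
  byParity (odd t)                   _       _              = OddSquare.oddSquare t
  byParity (even zero)               _       ()
  byParity (even (suc zero))         _       (s≤s (s≤s ()))
  byParity (even (suc (suc zero)))   _       _              = order4Square
  byParity (even m@(suc (suc (suc _)))) smaller _ =
    Doubling.doubledSquare (smaller m<2m 3≤m′) (blockPattern m 3≤m′)
    where
    3≤m′ : 3 ≤ m
    3≤m′ = s≤s (s≤s (s≤s z≤n))
    m<2m : m < m * 2
    m<2m = subst (m <_) (double m) (m<m+n m (s≤s z≤n))
      where
      double : ∀ m → m + m ≡ m * 2
      double = solve-∀

-- The lexicographic product G[O_n]

Reach-trans : ∀ {G : Graph} {u v w} → Reach G u v → Reach G v w → Reach G u w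
Reach-trans r here           = r
Reach-trans r (step r′ v~w) = step (Reach-trans r r′) v~w

Reach⇒lastEdge : ∀ {G : Graph} {u v} → Reach G u v → u ≢ v → ∃ λ w → Reach G u w × Adj G w v
Reach⇒lastEdge here          u≢u = ⊥-elim (u≢u refl)
Reach⇒lastEdge (step r w~v) _   = _ , r , w~v

module LexProduct (G : Graph) (n : ℕ) where

  private
    H : Graph
    H = lexNull G n

  project : Fin (V H) → Fin (V G)
  project w = proj₁ (remQuot {V G} n w)

  project-combine : ∀ u i → project (combine u i) ≡ u
  project-combine u i = cong proj₁ (remQuot-combine u i)

  ends-lex : ∀ e i j → ends H (combine e (combine i j)) ≡ (combine (proj₁ (ends G e)) i , combine (proj₂ (ends G e)) j)
  ends-lex e i j =
    trans (cong (λ (e , r) → ends-at e (remQuot n r)) (remQuot-combine e (combine i j)))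
          (cong (ends-at e) (remQuot-combine i j))
    where
    ends-at : Fin (q G) → Fin n × Fin n → Fin (V H) × Fin (V H)
    ends-at e (i , j) = combine (proj₁ (ends G e)) i , combine (proj₂ (ends G e)) j

  Adj-project : ∀ {w w′} → Adj H w w′ → Adj G (project w) (project w′)
  Adj-project (x , inj₁ (refl , refl)) = proj₁ (remQuot {q G} (n * n) x) , inj₁ (sym (project-combine _ _) , sym (project-combine _ _))
  Adj-project (x , inj₂ (refl , refl)) = proj₁ (remQuot {q G} (n * n) x) , inj₂ (sym (project-combine _ _) , sym (project-combine _ _))

  Adj-combine : ∀ {u v} → Adj G u v → ∀ i j → Adj H (combine u i) (combine v j)
  Adj-combine (e , inj₁ (refl , refl)) i j =
    combine e (combine i j) , subst (λ p → SameEnds p _) (sym (ends-lex e i j)) (inj₁ (refl , refl))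
  Adj-combine (e , inj₂ (refl , refl)) i j =
    combine e (combine j i) , subst (λ p → SameEnds p _) (sym (ends-lex e j i)) (inj₂ (refl , refl))

  Reach-combine : ∀ {a c b} → Reach G a c → Adj G c b → Fin n → ∀ i j → Reach H (combine a i) (combine b j)
  Reach-combine here         c~b z i j = step here (Adj-combine c~b i j)
  Reach-combine (step r d~c) c~b z i j = step (Reach-combine r d~c z i z) (Adj-combine c~b z j)

  -- Vertices in the same fibre are not adjacent, so walks must leave the fibre: G needs two vertices.
  connected : Connected G → ∀ {u v} → u ≢ v → Fin n → Connected H
  connected conn {u} {v} u≢v z w w′ =
    subst₂ (Reach H) (combine-remQuot {V G} n w) (combine-remQuot {V G} n w′) (walk (project w) _ (project w′) _)
    where
    via : ∀ {a b} x → x ≢ b → ∀ i j → Reach H (combine a i) (combine b j)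
    via {a} {b} x x≢b i j with c , x⇝c , c~b ← Reach⇒lastEdge (conn x b) x≢b =
      Reach-combine (Reach-trans (conn a x) x⇝c) c~b z i j
    walk : ∀ a i b j → Reach H (combine a i) (combine b j)
    walk a i b j with u ≟ᶠ b
    ... | no u≢b   = via u u≢b i j
    ... | yes refl = via v (u≢v ∘ sym) i j

  balancedBipartite : BalancedBipartite G → BalancedBipartite H
  balancedBipartite (side , proper , balanced) =
    side ∘ project , (λ w w′ w~w′ → proper _ _ (Adj-project w~w′)) ,
    trans (count-lift true) (trans (cong (n *_) balanced) (sym (count-lift false)))
    where
    count-lift : ∀ b → count (side ∘ project) b ≡ n * count side b
    count-lift b = begin
      count (side ∘ project) b                         ≡⟨ ∑-combine (V G) n _ ⟩
      ∑ (V G) (λ u → ∑ n (λ i → indicator (project (combine u i)))) ≡⟨ ∑-cong (V G) (λ u → ∑-cong n (λ i → cong indicator (project-combine u i))) ⟩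
      ∑ (V G) (λ u → ∑ n (λ _ → indicator u))         ≡⟨ ∑-cong (V G) (λ u → ∑-const n (indicator u)) ⟩
      ∑ (V G) (λ u → n * indicator u)                  ≡⟨ *-distribˡ-∑ (V G) n indicator ⟨
      n * count side b                                 ∎
      where
      open ≡-Reasoning
      indicator : Fin (V G) → ℕ
      indicator u = if does (side u ≟ᵇ b) then 1 else 0

≟-combine : ∀ {m n} (u a : Fin m) (i i′ : Fin n) →
            does (combine u i ≟ᶠ combine a i′) ≡ does (u ≟ᶠ a) ∧ does (i ≟ᶠ i′)
≟-combine u a i i′ with u ≟ᶠ a | i ≟ᶠ i′
... | yes refl | yes refl = dec-true (combine u i ≟ᶠ combine u i) refl
... | yes refl | no i≢i′  = dec-false (combine u i ≟ᶠ combine u i′) (i≢i′ ∘ combine-injectiveʳ u i u i′)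
... | no u≢a   | _        = dec-false (combine u i ≟ᶠ combine a i′) (u≢a ∘ combine-injectiveˡ u i a i′)

module LiftedLabeling (G : Graph) (simple : Simple G) (f : Labeling G)
                      {n} .{{_ : NonZero n}} (S : SemiMagicSquare n) where

  open SemiMagicSquare S
  open LexProduct G n

  private
    H : Graph
    H = lexNull G n

    entryIndex : Fin n × Fin n → Fin (n * n)
    entryIndex (i , j) = fromℕ< (entry< i j)

    entryIndex-injective : ∀ {p p′} → entryIndex p ≡ entryIndex p′ → p ≡ p′
    entryIndex-injective {i , j} {i′ , j′} eq =
      ×-≡,≡→≡ (entry-injective (trans (sym (toℕ-fromℕ< (entry< i j))) (trans (cong toℕ eq) (toℕ-fromℕ< (entry< i′ j′)))))

    -- Edge (e, i, j) of H gets label n² (f e − 1) + entry i j + 1.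
    labelAt : Fin (q G) × Fin (n * n) → Fin (q H)
    labelAt (e , r) = combine (lab f e) (entryIndex (remQuot n r))

    labelAt-injective : ∀ {p p′} → labelAt p ≡ labelAt p′ → p ≡ p′
    labelAt-injective {e , r} {e′ , r′} eq =
      ×-≡,≡→≡ (proj₁ (bij f) (combine-injectiveˡ (lab f e) _ (lab f e′) _ eq) ,
               remQuot-injective n (entryIndex-injective (combine-injectiveʳ (lab f e) _ (lab f e′) _ eq)))

    lab′ : Fin (q H) → Fin (q H)
    lab′ x = labelAt (remQuot {q G} (n * n) x)

    lab′-injective : Injective _≡_ _≡_ lab′
    lab′-injective eq = remQuot-injective (n * n) (labelAt-injective eq)

  lifted : Labeling H
  lifted = mkLabeling lab′ (lab′-injective , injective⇒surjective (q H) lab′ lab′-injective)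

  private
    edgeLabel : Fin (q G) → Fin n → Fin n → ℕ
    edgeLabel e i j = suc (n * n * toℕ (lab f e) + entry i j)

    label-lifted : ∀ e i j → label {H} lifted (combine e (combine i j)) ≡ edgeLabel e i j
    label-lifted e i j = cong suc (begin
      toℕ (lab′ (combine e (combine i j)))               ≡⟨ cong (toℕ ∘ labelAt) (remQuot-combine e (combine i j)) ⟩
      toℕ (labelAt (e , combine i j))                    ≡⟨ cong (λ p → toℕ (combine (lab f e) (entryIndex p))) (remQuot-combine i j) ⟩
      toℕ (combine (lab f e) (entryIndex (i , j)))       ≡⟨ toℕ-combine (lab f e) (entryIndex (i , j)) ⟩
      n * n * toℕ (lab f e) + toℕ (entryIndex (i , j))   ≡⟨ cong (n * n * toℕ (lab f e) +_) (toℕ-fromℕ< (entry< i j)) ⟩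
      n * n * toℕ (lab f e) + entry i j                  ∎)
      where open ≡-Reasoning

    incident-lifted : ∀ u i e i′ j′ → incident H (combine u i) (combine e (combine i′ j′)) ≡
      (does (u ≟ᶠ proj₁ (ends G e)) ∧ does (i ≟ᶠ i′)) ∨ (does (u ≟ᶠ proj₂ (ends G e)) ∧ does (i ≟ᶠ j′))
    incident-lifted u i e i′ j′ =
      trans (cong (λ (a , b) → does (combine u i ≟ᶠ a) ∨ does (combine u i ≟ᶠ b)) (ends-lex e i′ j′))
            (cong₂ _∨_ (≟-combine u _ i i′) (≟-combine u _ i j′))

    blockSum : ℕ → ℕ
    blockSum ℓ = n * suc (n * n * ℓ) + lineSum

    ∑-edgeLabel : ∀ e {g : Fin n → ℕ} → ∑ n g ≡ lineSum → ∑ n (λ j → suc (n * n * toℕ (lab f e)) + g j) ≡ blockSum (toℕ (lab f e))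
    ∑-edgeLabel e {g} ∑g = trans (∑-distrib-+ n _ g) (cong₂ _+_ (∑-const n _) ∑g)

    edgeSum : ∀ u i e →
      ∑ n (λ i′ → ∑ n (λ j′ → if (does (u ≟ᶠ proj₁ (ends G e)) ∧ does (i ≟ᶠ i′)) ∨ (does (u ≟ᶠ proj₂ (ends G e)) ∧ does (i ≟ᶠ j′))
                                then edgeLabel e i′ j′ else 0))
        ≡ (if incident G u e then blockSum (toℕ (lab f e)) else 0)
    edgeSum u i e with u ≟ᶠ proj₁ (ends G e) | u ≟ᶠ proj₂ (ends G e)
    ... | yes refl | yes u≡b = ⊥-elim (proj₁ simple e u≡b)
    ... | yes refl | no _ = begin
      ∑ n (λ i′ → ∑ n (λ j′ → if does (i ≟ᶠ i′) ∨ false then edgeLabel e i′ j′ else 0))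
        ≡⟨ ∑-cong n (λ i′ → trans (∑-cong n λ j′ → cong (λ c → if c then edgeLabel e i′ j′ else 0) (∨-identityʳ _))
                                  (∑-if n _ (edgeLabel e i′))) ⟩
      ∑ n (λ i′ → if does (i ≟ᶠ i′) then ∑ n (edgeLabel e i′) else 0)   ≡⟨ ∑-indicator n i _ ⟩
      ∑ n (edgeLabel e i)                                                ≡⟨ ∑-edgeLabel e (rowSum i) ⟩
      blockSum (toℕ (lab f e))                                           ∎
      where open ≡-Reasoning
    ... | no _ | yes refl = begin
      ∑ n (λ i′ → ∑ n (λ j′ → if does (i ≟ᶠ j′) then edgeLabel e i′ j′ else 0)) ≡⟨ ∑-cong n (λ i′ → ∑-indicator n i _) ⟩
      ∑ n (λ i′ → edgeLabel e i′ i)                                        ≡⟨ ∑-edgeLabel e (columnSum i) ⟩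
      blockSum (toℕ (lab f e))                                             ∎
      where open ≡-Reasoning
    ... | no _ | no _ = trans (∑-cong n (λ _ → ∑-zero n)) (∑-zero n)

    vsum-lifted-combine : ∀ u i → vsum H lifted (combine u i) ≡ ∑ (q G) (λ e → if incident G u e then blockSum (toℕ (lab f e)) else 0)
    vsum-lifted-combine u i = begin
      vsum H lifted (combine u i)
        ≡⟨ trans (∑-combine (q G) (n * n) _) (∑-cong (q G) (λ e → ∑-combine n n _)) ⟩
      ∑ (q G) (λ e → ∑ n (λ i′ → ∑ n (λ j′ → if incident H (combine u i) (combine e (combine i′ j′))
                                                then label {H} lifted (combine e (combine i′ j′)) else 0)))
        ≡⟨ ∑-cong (q G) (λ e → ∑-cong n (λ i′ → ∑-cong n (λ j′ →
             cong₂ (λ c l → if c then l else 0) (incident-lifted u i e i′ j′) (label-lifted e i′ j′)))) ⟩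
      _ ≡⟨ ∑-cong (q G) (edgeSum u i) ⟩
      ∑ (q G) (λ e → if incident G u e then blockSum (toℕ (lab f e)) else 0) ∎
      where open ≡-Reasoning

    blockSum+lineSum : ∀ c ℓ → (if c then blockSum ℓ else 0) + lineSum * (if c then 1 else 0) ≡ (if c then suc ℓ else 0) * n ^ 3
    blockSum+lineSum true ℓ = trans (regroup n lineSum ℓ) (trans (cong (n * (n * n * ℓ) +_) magicConstant) (cube n ℓ))
      where
      regroup : ∀ n s ℓ → n * suc (n * n * ℓ) + s + s * 1 ≡ n * (n * n * ℓ) + (2 * s + n)
      regroup = solve-∀
      cube : ∀ n ℓ → n * (n * n * ℓ) + n * (n * (n * 1)) ≡ suc ℓ * (n * (n * (n * 1)))
      cube = solve-∀
    blockSum+lineSum false ℓ = *-zeroʳ lineSum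

  vsum-lifted : ∀ w → vsum H lifted w + lineSum * deg G (project w) ≡ vsum G f (project w) * n ^ 3
  vsum-lifted w = begin
    vsum H lifted w + lineSum * deg G u
      ≡⟨ cong (λ x → vsum H lifted x + lineSum * deg G u) (combine-remQuot {V G} n w) ⟨
    vsum H lifted (combine u (proj₂ (remQuot {V G} n w))) + lineSum * deg G u
      ≡⟨ cong₂ _+_ (vsum-lifted-combine u _) (*-distribˡ-∑ (q G) lineSum _) ⟩
    ∑ (q G) (λ e → if incident G u e then blockSum (toℕ (lab f e)) else 0) + ∑ (q G) (λ e → lineSum * (if incident G u e then 1 else 0))
      ≡⟨ ∑-distrib-+ (q G) _ _ ⟨
    ∑ (q G) (λ e → (if incident G u e then blockSum (toℕ (lab f e)) else 0) + lineSum * (if incident G u e then 1 else 0))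
      ≡⟨ ∑-cong (q G) (λ e → trans (blockSum+lineSum (incident G u e) (toℕ (lab f e))) (*-comm _ (n ^ 3))) ⟩
    ∑ (q G) (λ e → n ^ 3 * (if incident G u e then label {G} f e else 0))
      ≡⟨ *-distribˡ-∑ (q G) (n ^ 3) _ ⟨
    n ^ 3 * vsum G f u
      ≡⟨ *-comm (n ^ 3) _ ⟩
    vsum G f u * n ^ 3 ∎
    where
    open ≡-Reasoning
    u = project w

  private
    halvedTerm : ∀ d → (n ^ 3 ∸ n) * d / 2 ≡ lineSum * d
    halvedTerm d = begin
      (n ^ 3 ∸ n) * d / 2             ≡⟨ cong (λ m → (m ∸ n) * d / 2) magicConstant ⟨
      (2 * lineSum + n ∸ n) * d / 2   ≡⟨ cong (λ m → m * d / 2) (m+n∸n≡m (2 * lineSum) n) ⟩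
      2 * lineSum * d / 2             ≡⟨ cong (_/ 2) (rearrange lineSum d) ⟩
      lineSum * d * 2 / 2             ≡⟨ m*n/n≡m (lineSum * d) 2 ⟩
      lineSum * d                     ∎
      where
      open ≡-Reasoning
      rearrange : ∀ s d → 2 * s * d ≡ s * d * 2
      rearrange = solve-∀

  vsum-lifted-ℤ : ∀ w → ℤ.+ (vsum G f (project w) * n ^ 3) ℤ.- ℤ.+ ((n ^ 3 ∸ n) * deg G (project w) / 2)
                        ≡ ℤ.+ vsum H lifted w
  vsum-lifted-ℤ w = begin
    ℤ.+ (vsum G f u * n ^ 3) ℤ.- ℤ.+ ((n ^ 3 ∸ n) * deg G u / 2)
      ≡⟨ cong₂ (λ a b → ℤ.+ a ℤ.- ℤ.+ b) (vsum-lifted w) (sym (halvedTerm (deg G u))) ⟨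
    ℤ.+ (vsum H lifted w + lineSum * deg G u) ℤ.- ℤ.+ (lineSum * deg G u)
      ≡⟨ [+a+b]-[+b]≡+a (vsum H lifted w) (lineSum * deg G u) ⟩
    ℤ.+ vsum H lifted w ∎
    where
    open ≡-Reasoning
    u = project w
    [+a+b]-[+b]≡+a : ∀ a b → ℤ.+ (a + b) ℤ.- ℤ.+ b ≡ ℤ.+ a
    [+a+b]-[+b]≡+a a b = trans (ℤₚ.m-n≡m⊖n (a + b) b) (trans (ℤₚ.⊖-≥ (m≤n+m b a)) (cong ℤ.+_ (m+n∸n≡m a b)))

  lifted-antimagic : (∀ u v → vsum G f u ≢ vsum G f v →
                        ℤ.+ (vsum G f u * n ^ 3) ℤ.- ℤ.+ ((n ^ 3 ∸ n) * deg G u / 2)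
                          ≢ ℤ.+ (vsum G f v * n ^ 3) ℤ.- ℤ.+ ((n ^ 3 ∸ n) * deg G v / 2)) →
                     IsLocalAntimagic G f → IsLocalAntimagic H lifted
  lifted-antimagic separated antimagic w w′ w~w′ eq =
    separated (project w) (project w′) (antimagic _ _ (Adj-project w~w′))
              (trans (vsum-lifted-ℤ w) (trans (cong ℤ.+_ eq) (sym (vsum-lifted-ℤ w′))))

  colorsOf-lifted≤ : (∀ u v → vsum G f u ≡ vsum G f v → deg G u ≡ deg G v) → colorsOf H lifted ≤ colorsOf G f
  colorsOf-lifted≤ same-deg = numValues-≤-factor (vsum G f) (vsum H lifted) project factors
    where
    factors : ∀ w w′ → vsum G f (project w) ≡ vsum G f (project w′) → vsum H lifted w ≡ vsum H lifted w′
    factors w w′ eq = +-cancelʳ-≡ (lineSum * deg G (project w)) _ _ (begin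
      vsum H lifted w + lineSum * deg G (project w)    ≡⟨ vsum-lifted w ⟩
      vsum G f (project w) * n ^ 3                     ≡⟨ cong (_* n ^ 3) eq ⟩
      vsum G f (project w′) * n ^ 3                    ≡⟨ vsum-lifted w′ ⟨
      vsum H lifted w′ + lineSum * deg G (project w′)  ≡⟨ cong (λ d → vsum H lifted w′ + lineSum * d) (same-deg (project w) (project w′) eq) ⟨
      vsum H lifted w′ + lineSum * deg G (project w)   ∎)
      where open ≡-Reasoning

-- Balanced bipartite graphs

module Bipartite (H : Graph) where

  IsBipartition : (Fin (V H) → Bool) → Set
  IsBipartition side = ∀ u v → Adj H u v → side u ≢ side v

  xor-constant : Connected H → ∀ {c c′} → IsBipartition c → IsBipartition c′ →
                 ∀ w w′ → c w xor c′ w ≡ c w′ xor c′ w′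
  xor-constant conn {c} {c′} c-proper c′-proper w w′ = along (conn w w′)
    where
    not-xor-not : ∀ x y → not x xor not y ≡ x xor y
    not-xor-not x y = trans (sym (not-distribˡ-xor x (not y)))
                            (trans (cong not (sym (not-distribʳ-xor x y))) (not-involutive (x xor y)))
    along : ∀ {v} → Reach H w v → c w xor c′ w ≡ c v xor c′ v
    along here            = refl
    along (step {v} r v~u) = trans (along r) (trans (sym (not-xor-not (c v) (c′ v)))
      (sym (cong₂ _xor_ (¬-not (c-proper _ _ v~u ∘ sym)) (¬-not (c′-proper _ _ v~u ∘ sym)))))

  bipartition-unique : Connected H → ∀ {c c′} → IsBipartition c → IsBipartition c′ →
                       ∀ w w′ → c w ≡ c w′ → c′ w ≡ c′ w′
  bipartition-unique conn {c} {c′} c-proper c′-proper w w′ c≡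
    with c w | c w′ | xor-constant conn c-proper c′-proper w w′
  ... | false | false | eq = eq
  ... | true  | true  | eq = not-injective eq

  ∑-side : (Fin (V H) → Bool) → Bool → (Fin (V H) → ℕ) → ℕ
  ∑-side side b h = ∑ (V H) (λ w → if does (side w ≟ᵇ b) then h w else 0)

  module _ {side} (proper : IsBipartition side) (g : Labeling H) (b : Bool) (x : Fin (q H)) where

    private
      summand : Fin (V H) → ℕ
      summand w = if does (side w ≟ᵇ b) then (if incident H w x then label {H} g x else 0) else 0

      not-incident : ∀ {w} → w ≢ proj₁ (ends H x) → w ≢ proj₂ (ends H x) → incident H w x ≡ false
      not-incident w≢c w≢d = cong₂ _∨_ (dec-false (_ ≟ᶠ _) w≢c) (dec-false (_ ≟ᶠ _) w≢d)

      unique-end : ∀ y → side y ≡ b → incident H y x ≡ true →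
                   (∀ w → w ≢ y → side w ≡ b → incident H w x ≡ false) → ∑ (V H) summand ≡ label {H} g x
      unique-end y y∈b y∼x others = trans (∑-single (V H) y summand off-y) at-y
        where
        at-y : summand y ≡ label {H} g x
        at-y rewrite dec-true (side y ≟ᵇ b) y∈b | y∼x = refl
        off-y : ∀ w → w ≢ y → summand w ≡ 0
        off-y w w≢y with side w ≟ᵇ b
        ... | yes w∈b rewrite others w w≢y w∈b = refl
        ... | no _    = refl

    -- Every edge has exactly one end on side b.
    ∑-side-edge : ∑ (V H) summand ≡ label {H} g x
    ∑-side-edge with side (proj₁ (ends H x)) ≟ᵇ b
    ... | yes c∈b = unique-end c c∈b (cong (_∨ does (c ≟ᶠ proj₂ (ends H x))) (dec-true (c ≟ᶠ c) refl))
                      (λ w w≢c w∈b → not-incident w≢c (λ { refl → c≁d (trans c∈b (sym w∈b)) }))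
      where
      c = proj₁ (ends H x)
      c≁d = proper c (proj₂ (ends H x)) (x , inj₁ (refl , refl))
    ... | no c∉b = unique-end d d∈b (trans (cong (does (d ≟ᶠ proj₁ (ends H x)) ∨_) (dec-true (d ≟ᶠ d) refl)) (∨-zeroʳ _))
                      (λ w w≢d w∈b → not-incident (λ { refl → c∉b w∈b }) w≢d)
      where
      d = proj₂ (ends H x)
      d∈b : side d ≡ b
      d∈b = trans (¬-not (proper _ d (x , inj₁ (refl , refl)) ∘ sym)) (sym (¬-not (c∉b ∘ sym)))

  ∑-side-vsum : ∀ {side} → IsBipartition side → (g : Labeling H) → ∀ b → ∑-side side b (vsum H g) ≡ ∑ (q H) (label {H} g)
  ∑-side-vsum {side} proper g b = begin
    ∑-side side b (vsum H g)
      ≡⟨ ∑-cong (V H) (λ w → ∑-if (q H) _ _) ⟨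
    ∑ (V H) (λ w → ∑ (q H) (λ x → if does (side w ≟ᵇ b) then (if incident H w x then label {H} g x else 0) else 0))
      ≡⟨ ∑-comm (V H) (q H) _ ⟩
    ∑ (q H) (λ x → ∑ (V H) (λ w → if does (side w ≟ᵇ b) then (if incident H w x then label {H} g x else 0) else 0))
      ≡⟨ ∑-cong (q H) (∑-side-edge proper g b) ⟩
    ∑ (q H) (label {H} g) ∎
    where open ≡-Reasoning

  ∑-side-constant : ∀ side b h s → (∀ w → side w ≡ b → h w ≡ s) → ∑-side side b h ≡ count side b * s
  ∑-side-constant side b h s constant =
    trans (∑-cong (V H) pointwise) (trans (sym (*-distribˡ-∑ (V H) s _)) (*-comm s (count side b)))
    where
    pointwise : ∀ w → (if does (side w ≟ᵇ b) then h w else 0) ≡ s * (if does (side w ≟ᵇ b) then 1 else 0)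
    pointwise w with side w ≟ᵇ b
    ... | yes w∈b = trans (constant w w∈b) (sym (*-identityʳ s))
    ... | no _    = sym (*-zeroʳ s)

  count-nonempty : ∀ side w → 1 ≤ count side (side w)
  count-nonempty side w =
    ≤-trans (≤-reflexive (cong (λ c → if c then 1 else 0) (sym (dec-true (side w ≟ᵇ side w) refl))))
            (term≤∑ (V H) (λ u → if does (side u ≟ᵇ side w) then 1 else 0) w)

  -- The two value classes of the labeling form a bipartition, hence the given one; counting
  -- labels over the two equal sides then forces both values to coincide.
  balanced⇒numValues≢2 : Connected H → BalancedBipartite H →
                         (g : Labeling H) → IsLocalAntimagic H g → numValues (vsum H g) ≢ 2
  balanced⇒numValues≢2 conn (side , proper , balanced) g antimagic two
    with s , t , twoValued ← numValues≡2⇒twoValued (vsum H g) two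
    with u , v , hu≢hv ← 2≤numValues⇒nonconstant (vsum H g) (≤-reflexive (sym two))
    = hu≢hv (*-cancelˡ-≡ (h u) (h v) (count side (side u)) {{>-nonZero (count-nonempty side u)}} (begin
      count side (side u) * h u        ≡⟨ ∑-side-constant side (side u) h (h u) (λ w w∈ → constant-on-sides w u w∈) ⟨
      ∑-side side (side u) h           ≡⟨ ∑-side-vsum proper g (side u) ⟩
      ∑ (q H) (label {H} g)            ≡⟨ ∑-side-vsum proper g (side v) ⟨
      ∑-side side (side v) h           ≡⟨ ∑-side-constant side (side v) h (h v) (λ w w∈ → constant-on-sides w v w∈) ⟩
      count side (side v) * h v        ≡⟨ cong (_* h v) (balanced-opposite (side u) (side v) v-opposite) ⟩
      count side (side u) * h v        ∎))
    where
    open ≡-Reasoning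
    h = vsum H g
    inS : Fin (V H) → Bool
    inS w = does (h w ≟ s)
    value : ∀ w → h w ≡ (if inS w then s else t)
    value w with twoValued w | h w ≟ s
    ... | _         | yes hw≡s = trans hw≡s (cong (λ c → if c then s else t) (sym (dec-true (h w ≟ s) hw≡s)))
    ... | inj₁ hw≡s | no hw≢s  = ⊥-elim (hw≢s hw≡s)
    ... | inj₂ hw≡t | no hw≢s  = trans hw≡t (cong (λ c → if c then s else t) (sym (dec-false (h w ≟ s) hw≢s)))
    same-class : ∀ {w w′} → inS w ≡ inS w′ → h w ≡ h w′
    same-class {w} {w′} eq = trans (value w) (trans (cong (λ c → if c then s else t) eq) (sym (value w′)))
    constant-on-sides : ∀ w w′ → side w ≡ side w′ → h w ≡ h w′
    constant-on-sides w w′ =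
      same-class {w} {w′} ∘ bipartition-unique conn proper (λ x y x~y → antimagic x y x~y ∘ same-class {x} {y}) w w′
    v-opposite : side v ≢ side u
    v-opposite eq = hu≢hv (constant-on-sides u v (sym eq))
    balanced-opposite : ∀ b b′ → b′ ≢ b → count side b′ ≡ count side b
    balanced-opposite false false b′≢b = ⊥-elim (b′≢b refl)
    balanced-opposite false true  _    = balanced
    balanced-opposite true  false _    = sym balanced
    balanced-opposite true  true  b′≢b = ⊥-elim (b′≢b refl)

-- Colourings

valueColoring-proper : ∀ {H} {g : Labeling H} → IsLocalAntimagic H g →
                       ProperColoring H (colorsOf H g) (valueColoring (vsum H g))
valueColoring-proper {H} {g} antimagic u v u~v = antimagic u v u~v ∘ valueColoring-reflects (vsum H g) u v

χ≤χla : ∀ {H c k} → IsChromatic H c → IsChiLa H k → c ≤ k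
χ≤χla {H} (_ , minimal) ((g , antimagic , colors) , _) =
  subst (_ ≤_) colors (minimal _ _ (valueColoring-proper {H} {g} antimagic))

module _ (G : Graph) (n : ℕ) where

  open LexProduct G n

  χ≤χla-lex : Fin n → ∀ {k k′} → IsChromatic G k → IsChiLa (lexNull G n) k′ → k ≤ k′
  χ≤χla-lex z (_ , minimal) ((g , antimagic , colors) , _) = subst (_ ≤_) colors
    (minimal _ (λ u → valueColoring (vsum (lexNull G n) g) (combine u z))
               (λ u v u~v → valueColoring-proper {lexNull G n} {g} antimagic _ _ (Adj-combine u~v z z)))

  3≤χla-lex : Connected G → BalancedBipartite G → ∀ {u v} → u ≢ v → Fin n →
              ∀ {k′} → IsChiLa (lexNull G n) k′ → 3 ≤ k′
  3≤χla-lex conn balanced {u} {v} u≢v z ((g , antimagic , colors) , _)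
    with c , _ , c~v ← Reach⇒lastEdge (conn u v) u≢v
    with 2≤k′ ← subst (2 ≤_) colors (2≤numValues (vsum (lexNull G n) g) (combine c z) (combine v z)
                                                   (antimagic _ _ (Adj-combine c~v z z)))
    with m≤n⇒m<n∨m≡n 2≤k′
  ... | inj₁ 3≤k′ = 3≤k′
  ... | inj₂ 2≡k′ = ⊥-elim (Bipartite.balanced⇒numValues≢2 (lexNull G n) (connected conn u≢v z)
                              (balancedBipartite balanced) g antimagic (trans colors (sym 2≡k′)))

open import Data.Integer using (+_; _-_)

theorem2p1 : (G : Graph) → Simple G → Connected G →
    (k : ℕ) → IsChiLa G k →
    (f : Labeling G) → IsLocalAntimagic G f → colorsOf G f ≡ k →
    (n : ℕ) → 3 ≤ n →
    (∀ u v → vsum G f u ≡ vsum G f v → deg G u ≡ deg G v) →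
    (∀ u v → vsum G f u ≢ vsum G f v →
      (+ (vsum G f u * n ^ 3) - + ((n ^ 3 ∸ n) * deg G u / 2))
        ≢ (+ (vsum G f v * n ^ 3) - + ((n ^ 3 ∸ n) * deg G v / 2))) →
    Σ ℕ λ k′ → IsChiLa (lexNull G n) k′
      × (∀ c → IsChromatic (lexNull G n) c → c ≤ k′)
      × k′ ≤ k
      × ((IsChromatic G k ⊎ (BalancedBipartite G × k ≡ 3)) → k′ ≡ k)
theorem2p1 G simple conn k _ f antimagic f-k n 3≤n same-deg separated =
  k′ , χla-k′ , (λ c χ-c → χ≤χla χ-c χla-k′) , k′≤k , k′≡k
  where
  0<n : 0 < n
  0<n = ≤-trans (s≤s z≤n) 3≤n
  open LiftedLabeling G simple f {{>-nonZero 0<n}} (semiMagicSquare n 3≤n)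
  χla-lifted = χla-exists (lexNull G n) lifted (lifted-antimagic separated antimagic)
  k′ = proj₁ χla-lifted
  χla-k′ = proj₂ χla-lifted
  k′≤k : k′ ≤ k
  k′≤k = ≤-trans (proj₂ χla-k′ lifted (lifted-antimagic separated antimagic))
                 (subst (colorsOf (lexNull G n) lifted ≤_) f-k (colorsOf-lifted≤ same-deg))
  k′≡k : IsChromatic G k ⊎ (BalancedBipartite G × k ≡ 3) → k′ ≡ k
  k′≡k (inj₁ χ-k) = ≤-antisym k′≤k (χ≤χla-lex G n (fromℕ< 0<n) χ-k χla-k′)
  k′≡k (inj₂ (balanced , k≡3))
    with u , v , fu≢fv ← 2≤numValues⇒nonconstant (vsum G f) (subst (2 ≤_) (sym (trans f-k k≡3)) (s≤s (s≤s z≤n)))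
    = ≤-antisym k′≤k (subst (_≤ k′) (sym k≡3)
        (3≤χla-lex G n conn balanced {u} {v} (fu≢fv ∘ cong (vsum G f)) (fromℕ< 0<n) χla-k′))
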